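{- Let $\ell,z\ge1$ be integers. Let $G_0$ be a $z$-degenerate graph on $q$ vertices with maximum degree $\Delta$. Then the number of paths of length $\ell$ in $G_0$ is at most $q\cdot 2^{\ell}z^{\lceil \ell/2\rceil}\Delta^{\lfloor \ell/2\rfloor}$.
   Context: A graph is $z$-degenerate if every subgraph of it has a vertex of degree at most $z$. A path of length $\ell$ is a path with $\ell$ edges. -}

module Defs where

open import Data.Nat using (ℕ; zero; suc; _≤_; _<ᵇ_; _⊔_)
open import Data.Bool using (Bool; true; false; T; _∧_; not)
open import Data.Fin using (Fin; toℕ; _≟_)
open import Data.List using (List; []; _∷_; length; filterᵇ; allFin; map; concatMap; foldr; last; head)
open import Data.Bool.ListAction using (any)
open import Data.Maybe using (Maybe; just; nothing)
open import Data.Product using (Σ; _×_; ∃)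
open import Relation.Nullary.Decidable using (⌊_⌋)
open import Relation.Binary.PropositionalEquality using (_≡_)

record Graph (q : ℕ) : Set where
  field
    adj     : Fin q → Fin q → Bool
    adj-sym : ∀ u v → adj u v ≡ adj v u
    irrefl  : ∀ v → adj v v ≡ false
open Graph public

deg : ∀ {q} → Graph q → Fin q → ℕ
deg {q} G v = length (filterᵇ (adj G v) (allFin q))

maxDeg : ∀ {q} → Graph q → ℕ
maxDeg {q} G = foldr (λ v m → deg G v ⊔ m) 0 (allFin q)

record Subgraph {q : ℕ} (G : Graph q) : Set where
  field
    vert     : Fin q → Bool
    edge     : Fin q → Fin q → Bool
    edge-sym : ∀ u v → edge u v ≡ edge v u
    edge⊆G   : ∀ u v → T (edge u v) → T (adj G u v)
    edge-in  : ∀ u v → T (edge u v) → T (vert u)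
open Subgraph public

subDeg : ∀ {q} {G : Graph q} → Subgraph G → Fin q → ℕ
subDeg {q} H v = length (filterᵇ (edge H v) (allFin q))

Degenerate : ∀ {q} → ℕ → Graph q → Set
Degenerate {q} z G =
  (H : Subgraph G) → ∃ (λ (v : Fin q) → T (vert H v)) →
  ∃ (λ (v : Fin q) → T (vert H v) × subDeg H v ≤ z)

allLists : (q n : ℕ) → List (List (Fin q))
allLists q zero    = [] ∷ []
allLists q (suc n) = concatMap (λ v → map (v ∷_) (allLists q n)) (allFin q)

distinct : ∀ {q} → List (Fin q) → Bool
distinct []       = true
distinct (v ∷ vs) = not (any (λ w → ⌊ v ≟ w ⌋) vs) ∧ distinct vs

walkᵇ : ∀ {q} → Graph q → List (Fin q) → Bool
walkᵇ G []           = true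
walkᵇ G (v ∷ [])     = true
walkᵇ G (u ∷ v ∷ vs) = adj G u v ∧ walkᵇ G (v ∷ vs)

-- Used to pick exactly one of
-- the two vertex sequences traversing a path (with ≥ 1 edge), so that paths
-- are counted as subgraphs, not as directed sequences.
canonical : ∀ {q} → List (Fin q) → Bool
canonical [] = false
canonical (v ∷ vs) with last (v ∷ vs)
... | just w  = toℕ v <ᵇ toℕ w
... | nothing = false

isPathᵇ : ∀ {q} → Graph q → List (Fin q) → Bool
isPathᵇ G vs = distinct vs ∧ walkᵇ G vs ∧ canonical vs

numPaths : ∀ {q} → Graph q → ℕ → ℕ
numPaths {q} G ℓ = length (filterᵇ (isPathᵇ G) (allLists q (suc ℓ)))

-- Repeatedly deleting a vertex of degree at most z orders the vertices so that each has at most z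
-- neighbours later in the order; orient every edge towards its later endpoint.  Of the ℓ steps of a
-- path, at least ⌈ℓ/2⌉ go forward in one of its two traversal directions, so choosing that direction
-- maps the paths injectively to walks with at least ⌈ℓ/2⌉ forward steps.  If W(k, t) bounds the
-- number of walks from any vertex with k steps of which at least t are forward, then counting by the
-- first step gives W(k, t) ≤ z·W(k-1, t-1) + Δ·W(k-1, t), whence W(k, t) ≤ 2^k z^t Δ^(k-t).
module Submission where

open import Defs

open import Algebra.Properties.CommutativeSemigroup using (interchange)
open import Data.Bool using (Bool; true; false; T; _∧_; not)
open import Data.Bool.Properties using (T-∧)
open import Data.Empty using (⊥-elim)
open import Data.Fin using (Fin; toℕ; _≟_)
open import Data.Fin.Properties using (any?)
open import Data.List
  using (List; []; _∷_; _∷ʳ_; [_]; _++_; foldr; last; length; filterᵇ; allFin; map; concatMap; reverse)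
open import Data.List.Membership.Propositional using (_∈_)
open import Data.List.Membership.Propositional.Properties using (∈-allFin)
open import Data.List.Properties using (map-++; map-∘; length-tabulate; unfold-reverse; reverse-++)
open import Data.List.Relation.Binary.Permutation.Propositional using (↭-sym)
open import Data.List.Relation.Binary.Permutation.Propositional.Properties
  using (↭-reverse; map⁺; All-resp-↭)
open import Data.List.Relation.Unary.All using (All; []; _∷_)
import Data.List.Relation.Unary.All as All
import Data.List.Relation.Unary.All.Properties as All
open import Data.List.Relation.Unary.Any using (here; there)
open import Data.List.Reverse using (reverseView; []; _∶_∶ʳ_)
open import Data.Maybe using (just)
open import Data.Nat
  using ( ℕ; zero; suc; _+_; _*_; _∸_; _^_; _⊔_; _≤_; _<_; _≤ᵇ_; _<ᵇ_; _≤?_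
        ; z≤n; s≤s; s≤s⁻¹; z<s; ⌈_/2⌉; ⌊_/2⌋)
open import Data.Nat.ListAction using (sum)
open import Data.Nat.ListAction.Properties using (sum-++; sum-↭)
open import Data.Nat.Properties hiding (_≟_)
open import Data.Nat.Tactic.RingSolver using (solve-∀)
open import Data.Product using (_×_; _,_; proj₁; proj₂; swap; uncurry)
open import Data.Sum using (_⊎_; inj₁; inj₂)
open import Function using (_∘_; id; flip; Equivalence)
open import Relation.Binary.PropositionalEquality hiding ([_])
open import Relation.Nullary using (¬_; Dec; yes; no)
open import Relation.Nullary.Decidable using (⌊_⌋; T?)

𝟙 : Bool → ℕ
𝟙 true  = 1
𝟙 false = 0

𝟙≤1 : (b : Bool) → 𝟙 b ≤ 1
𝟙≤1 true  = ≤-refl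
𝟙≤1 false = z≤n

T⇒𝟙≡1 : {b : Bool} → T b → 𝟙 b ≡ 1
T⇒𝟙≡1 {true} _ = refl

¬T⇒𝟙≡0 : {b : Bool} → ¬ T b → 𝟙 b ≡ 0
¬T⇒𝟙≡0 {true}  ¬b = ⊥-elim (¬b _)
¬T⇒𝟙≡0 {false} _  = refl

𝟙-∧-≤ʳ : (a b : Bool) → 𝟙 (a ∧ b) ≤ 𝟙 b
𝟙-∧-≤ʳ true  b = ≤-refl
𝟙-∧-≤ʳ false b = z≤n

𝟙-∧-split : (a b : Bool) → 𝟙 (a ∧ b) + 𝟙 (a ∧ not b) ≡ 𝟙 a
𝟙-∧-split false b     = refl
𝟙-∧-split true  true  = refl
𝟙-∧-split true  false = refl

𝟙-≤-+ : {a b c : Bool} → (T a → T b ⊎ T c) → 𝟙 a ≤ 𝟙 b + 𝟙 c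
𝟙-≤-+ {false}                   _ = z≤n
𝟙-≤-+ {true}  {true}            _ = s≤s z≤n
𝟙-≤-+ {true}  {false} {true}    _ = s≤s z≤n
𝟙-≤-+ {true}  {false} {false} a⇒b∨c with a⇒b∨c _
... | inj₁ ()
... | inj₂ ()

T-not : {b : Bool} → ¬ T b → T (not b)
T-not {true}  ¬b = ¬b _
T-not {false} _  = _

∑ : {A : Set} → (A → ℕ) → List A → ℕ
∑ f xs = sum (map f xs)

module _ {A : Set} where

  length-filterᵇ : (p : A → Bool) (xs : List A) → length (filterᵇ p xs) ≡ ∑ (𝟙 ∘ p) xs
  length-filterᵇ p []       = refl
  length-filterᵇ p (x ∷ xs) with p x
  ... | true  = cong suc (length-filterᵇ p xs)
  ... | false = length-filterᵇ p xs

  ∑-++ : (f : A → ℕ) (xs ys : List A) → ∑ f (xs ++ ys) ≡ ∑ f xs + ∑ f ys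
  ∑-++ f xs ys = trans (cong sum (map-++ f xs ys)) (sum-++ (map f xs) (map f ys))

  ∑-reverse : (f : A → ℕ) (xs : List A) → ∑ f (reverse xs) ≡ ∑ f xs
  ∑-reverse f xs = sum-↭ (map⁺ f (↭-reverse xs))

  ∑-cong : {f g : A → ℕ} → (∀ x → f x ≡ g x) → (xs : List A) → ∑ f xs ≡ ∑ g xs
  ∑-cong f≗g []       = refl
  ∑-cong f≗g (x ∷ xs) = cong₂ _+_ (f≗g x) (∑-cong f≗g xs)

  ∑-mono-≤ : {f g : A → ℕ} → (∀ x → f x ≤ g x) → (xs : List A) → ∑ f xs ≤ ∑ g xs
  ∑-mono-≤ f≤g []       = z≤n
  ∑-mono-≤ f≤g (x ∷ xs) = +-mono-≤ (f≤g x) (∑-mono-≤ f≤g xs)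

  ∑-mono-< : {f g : A → ℕ} → (∀ x → f x ≤ g x) → {x : A} {xs : List A} →
             x ∈ xs → f x < g x → ∑ f xs < ∑ g xs
  ∑-mono-< f≤g {xs = y ∷ xs} (here refl) fx<gx = +-mono-<-≤ fx<gx (∑-mono-≤ f≤g xs)
  ∑-mono-< f≤g {xs = y ∷ xs} (there x∈xs) fx<gx = +-mono-≤-< (f≤g y) (∑-mono-< f≤g x∈xs fx<gx)

  ∈⇒≤∑ : (f : A → ℕ) {x : A} {xs : List A} → x ∈ xs → f x ≤ ∑ f xs
  ∈⇒≤∑ f {xs = y ∷ xs} (here refl)  = m≤m+n (f y) _
  ∈⇒≤∑ f {xs = y ∷ xs} (there x∈xs) = ≤-trans (∈⇒≤∑ f x∈xs) (m≤n+m _ (f y))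

  ∑-All-≡1 : {f : A → ℕ} {xs : List A} → All (λ x → f x ≡ 1) xs → ∑ f xs ≡ length xs
  ∑-All-≡1 []          = refl
  ∑-All-≡1 (fx≡1 ∷ fs) = cong₂ _+_ fx≡1 (∑-All-≡1 fs)

  ∑-zero : (xs : List A) → ∑ (λ _ → 0) xs ≡ 0
  ∑-zero []       = refl
  ∑-zero (x ∷ xs) = ∑-zero xs

  ∑-+ : (f g : A → ℕ) (xs : List A) → ∑ f xs + ∑ g xs ≡ ∑ (λ x → f x + g x) xs
  ∑-+ f g []       = refl
  ∑-+ f g (x ∷ xs) = trans (interchange +-commutativeSemigroup (f x) (∑ f xs) (g x) (∑ g xs))
                           (cong (f x + g x +_) (∑-+ f g xs))

  ∑-*ʳ : (f : A → ℕ) (c : ℕ) (xs : List A) → ∑ (λ x → f x * c) xs ≡ ∑ f xs * c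
  ∑-*ʳ f c []       = refl
  ∑-*ʳ f c (x ∷ xs) = trans (cong (f x * c +_) (∑-*ʳ f c xs)) (sym (*-distribʳ-+ c (f x) (∑ f xs)))

  ∑-≤-length* : {f : A → ℕ} {c : ℕ} → (∀ x → f x ≤ c) → (xs : List A) → ∑ f xs ≤ length xs * c
  ∑-≤-length* f≤c []       = z≤n
  ∑-≤-length* f≤c (x ∷ xs) = +-mono-≤ (f≤c x) (∑-≤-length* f≤c xs)

module _ {A B : Set} where

  ∑-map : (f : B → ℕ) (g : A → B) (xs : List A) → ∑ f (map g xs) ≡ ∑ (f ∘ g) xs
  ∑-map f g xs = cong sum (sym (map-∘ xs))

  ∑-concatMap : (f : B → ℕ) (g : A → List B) (xs : List A) →
                ∑ f (concatMap g xs) ≡ ∑ (∑ f ∘ g) xs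
  ∑-concatMap f g []       = refl
  ∑-concatMap f g (x ∷ xs) =
    trans (∑-++ f (g x) (concatMap g xs)) (cong (∑ f (g x) +_) (∑-concatMap f g xs))

  ∑-comm : (f : A → B → ℕ) (xs : List A) (ys : List B) →
           ∑ (λ x → ∑ (f x) ys) xs ≡ ∑ (λ y → ∑ (λ x → f x y) xs) ys
  ∑-comm f []       ys = sym (∑-zero ys)
  ∑-comm f (x ∷ xs) ys =
    trans (cong (∑ (f x) ys +_) (∑-comm f xs ys)) (∑-+ (f x) (λ y → ∑ (λ x → f x y) xs) ys)

module _ {q : ℕ} where

  ∑-allLists-∷ : (f : List (Fin q) → ℕ) (k : ℕ) →
                 ∑ f (allLists q (suc k)) ≡ ∑ (λ v → ∑ (f ∘ (v ∷_)) (allLists q k)) (allFin q)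
  ∑-allLists-∷ f k = trans (∑-concatMap f (λ v → map (v ∷_) (allLists q k)) (allFin q))
                           (∑-cong (λ v → ∑-map f (v ∷_) (allLists q k)) (allFin q))

  ∑-allLists-∷ʳ : (f : List (Fin q) → ℕ) (k : ℕ) →
                  ∑ f (allLists q (suc k)) ≡ ∑ (λ v → ∑ (λ xs → f (xs ∷ʳ v)) (allLists q k)) (allFin q)
  ∑-allLists-∷ʳ f zero    = ∑-allLists-∷ f zero
  ∑-allLists-∷ʳ f (suc k) = begin
    ∑ f (allLists q (suc (suc k)))
      ≡⟨ ∑-allLists-∷ f (suc k) ⟩
    ∑ (λ u → ∑ (f ∘ (u ∷_)) (allLists q (suc k))) (allFin q)
      ≡⟨ ∑-cong (λ u → ∑-allLists-∷ʳ (f ∘ (u ∷_)) k) (allFin q) ⟩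
    ∑ (λ u → ∑ (λ v → ∑ (λ xs → f (u ∷ xs ∷ʳ v)) (allLists q k)) (allFin q)) (allFin q)
      ≡⟨ ∑-comm (λ u v → ∑ (λ xs → f (u ∷ xs ∷ʳ v)) (allLists q k)) (allFin q) (allFin q) ⟩
    ∑ (λ v → ∑ (λ u → ∑ (λ xs → f (u ∷ xs ∷ʳ v)) (allLists q k)) (allFin q)) (allFin q)
      ≡⟨ ∑-cong (λ v → sym (∑-allLists-∷ (λ xs → f (xs ∷ʳ v)) k)) (allFin q) ⟩
    ∑ (λ v → ∑ (λ xs → f (xs ∷ʳ v)) (allLists q (suc k))) (allFin q)
      ∎
    where open ≡-Reasoning

  ∑-allLists-reverse : (f : List (Fin q) → ℕ) (k : ℕ) →
                       ∑ (f ∘ reverse) (allLists q k) ≡ ∑ f (allLists q k)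
  ∑-allLists-reverse f zero    = refl
  ∑-allLists-reverse f (suc k) = begin
    ∑ (f ∘ reverse) (allLists q (suc k))
      ≡⟨ ∑-allLists-∷ (f ∘ reverse) k ⟩
    ∑ (λ v → ∑ (λ xs → f (reverse (v ∷ xs))) (allLists q k)) (allFin q)
      ≡⟨ ∑-cong (λ v → ∑-cong (λ xs → cong f (unfold-reverse v xs)) (allLists q k)) (allFin q) ⟩
    ∑ (λ v → ∑ (λ xs → f (reverse xs ∷ʳ v)) (allLists q k)) (allFin q)
      ≡⟨ ∑-cong (λ v → ∑-allLists-reverse (λ xs → f (xs ∷ʳ v)) k) (allFin q) ⟩
    ∑ (λ v → ∑ (λ xs → f (xs ∷ʳ v)) (allLists q k)) (allFin q)
      ≡⟨ ∑-allLists-∷ʳ f k ⟨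
    ∑ f (allLists q (suc k))
      ∎
    where open ≡-Reasoning

  ∑-allLists-reverse-split : (P c : List (Fin q) → Bool) (k : ℕ) →
    ∑ (λ xs → 𝟙 (P xs ∧ c xs) + 𝟙 (P (reverse xs) ∧ not (c (reverse xs)))) (allLists q k)
      ≡ ∑ (𝟙 ∘ P) (allLists q k)
  ∑-allLists-reverse-split P c k = begin
    ∑ (λ xs → 𝟙 (Pc xs) + 𝟙 (P¬c (reverse xs))) L
      ≡⟨ ∑-+ (𝟙 ∘ Pc) (𝟙 ∘ P¬c ∘ reverse) L ⟨
    ∑ (𝟙 ∘ Pc) L + ∑ (𝟙 ∘ P¬c ∘ reverse) L
      ≡⟨ cong (∑ (𝟙 ∘ Pc) L +_) (∑-allLists-reverse (𝟙 ∘ P¬c) k) ⟩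
    ∑ (𝟙 ∘ Pc) L + ∑ (𝟙 ∘ P¬c) L
      ≡⟨ ∑-+ (𝟙 ∘ Pc) (𝟙 ∘ P¬c) L ⟩
    ∑ (λ xs → 𝟙 (Pc xs) + 𝟙 (P¬c xs)) L
      ≡⟨ ∑-cong (λ xs → 𝟙-∧-split (P xs) (c xs)) L ⟩
    ∑ (𝟙 ∘ P) L
      ∎
    where
    open ≡-Reasoning
    L : List (List (Fin q))
    L = allLists q k
    Pc P¬c : List (Fin q) → Bool
    Pc  xs = P xs ∧ c xs
    P¬c xs = P xs ∧ not (c xs)

  ∑-allLists-mono-≤ : {f g : List (Fin q) → ℕ} (k : ℕ) →
                      (∀ xs → length xs ≡ k → f xs ≤ g xs) →
                      ∑ f (allLists q k) ≤ ∑ g (allLists q k)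
  ∑-allLists-mono-≤ zero    f≤g = +-monoˡ-≤ 0 (f≤g [] refl)
  ∑-allLists-mono-≤ {f} {g} (suc k) f≤g = begin
    ∑ f (allLists q (suc k))
      ≡⟨ ∑-allLists-∷ f k ⟩
    ∑ (λ v → ∑ (f ∘ (v ∷_)) (allLists q k)) (allFin q)
      ≤⟨ ∑-mono-≤ (λ v → ∑-allLists-mono-≤ k (λ xs ∣xs∣≡k → f≤g (v ∷ xs) (cong suc ∣xs∣≡k))) (allFin q) ⟩
    ∑ (λ v → ∑ (g ∘ (v ∷_)) (allLists q k)) (allFin q)
      ≡⟨ ∑-allLists-∷ g k ⟨
    ∑ g (allLists q (suc k))
      ∎
    where open ≤-Reasoning

module _ {A : Set} where

  steps : List A → List (A × A)
  steps []           = []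
  steps (u ∷ [])     = []
  steps (u ∷ v ∷ vs) = (u , v) ∷ steps (v ∷ vs)

  length-steps : (x : A) (xs : List A) → length (steps (x ∷ xs)) ≡ length xs
  length-steps x []       = refl
  length-steps x (y ∷ xs) = cong suc (length-steps y xs)

  steps-∷ʳ : (xs : List A) (u v : A) → steps (xs ∷ʳ u ∷ʳ v) ≡ steps (xs ∷ʳ u) ∷ʳ (u , v)
  steps-∷ʳ []           u v = refl
  steps-∷ʳ (x ∷ [])     u v = refl
  steps-∷ʳ (x ∷ y ∷ xs) u v = cong ((x , y) ∷_) (steps-∷ʳ (y ∷ xs) u v)

  steps-reverse : (xs : List A) → steps (reverse xs) ≡ reverse (map swap (steps xs))
  steps-reverse []           = refl
  steps-reverse (u ∷ [])     = refl
  steps-reverse (u ∷ v ∷ vs) = begin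
    steps (reverse (u ∷ v ∷ vs))
      ≡⟨ cong steps (trans (unfold-reverse u (v ∷ vs)) (cong (_∷ʳ u) (unfold-reverse v vs))) ⟩
    steps (reverse vs ∷ʳ v ∷ʳ u)
      ≡⟨ steps-∷ʳ (reverse vs) v u ⟩
    steps (reverse vs ∷ʳ v) ∷ʳ (v , u)
      ≡⟨ cong (λ ws → steps ws ∷ʳ (v , u)) (unfold-reverse v vs) ⟨
    steps (reverse (v ∷ vs)) ∷ʳ (v , u)
      ≡⟨ cong (_∷ʳ (v , u)) (steps-reverse (v ∷ vs)) ⟩
    reverse (map swap (steps (v ∷ vs))) ∷ʳ (v , u)
      ≡⟨ unfold-reverse (v , u) (map swap (steps (v ∷ vs))) ⟨
    reverse (map swap (steps (u ∷ v ∷ vs)))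
      ∎
    where open ≡-Reasoning

  forward : (A → A → Bool) → List A → ℕ
  forward o xs = ∑ (𝟙 ∘ uncurry o) (steps xs)

  forward-reverse : (o : A → A → Bool) (xs : List A) → forward o (reverse xs) ≡ forward (flip o) xs
  forward-reverse o xs = begin
    ∑ (𝟙 ∘ uncurry o) (steps (reverse xs))
      ≡⟨ cong (∑ (𝟙 ∘ uncurry o)) (steps-reverse xs) ⟩
    ∑ (𝟙 ∘ uncurry o) (reverse (map swap (steps xs)))
      ≡⟨ ∑-reverse (𝟙 ∘ uncurry o) (map swap (steps xs)) ⟩
    ∑ (𝟙 ∘ uncurry o) (map swap (steps xs))
      ≡⟨ ∑-map (𝟙 ∘ uncurry o) swap (steps xs) ⟩
    forward (flip o) xs
      ∎
    where open ≡-Reasoning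

  forward≤length : (o : A → A → Bool) (xs : List A) → forward o xs ≤ length (steps xs)
  forward≤length o xs =
    ≤-trans (∑-≤-length* (λ p → 𝟙≤1 (uncurry o p)) (steps xs)) (≤-reflexive (*-identityʳ _))

  last-∷ʳ : (xs : List A) (x : A) → last (xs ∷ʳ x) ≡ just x
  last-∷ʳ []           x = refl
  last-∷ʳ (y ∷ [])     x = refl
  last-∷ʳ (y ∷ z ∷ xs) x = last-∷ʳ (z ∷ xs) x

  reverse-∷-∷ʳ : (x : A) (xs : List A) (y : A) → reverse (x ∷ xs ∷ʳ y) ≡ y ∷ reverse xs ∷ʳ x
  reverse-∷-∷ʳ x xs y = trans (unfold-reverse x (xs ∷ʳ y)) (cong (_∷ʳ x) (reverse-++ xs [ y ]))

module _ {q : ℕ} where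

  canonical-∷-∷ʳ : (v : Fin q) (vs : List (Fin q)) (w : Fin q) →
                   canonical (v ∷ vs ∷ʳ w) ≡ (toℕ v <ᵇ toℕ w)
  canonical-∷-∷ʳ v vs w rewrite last-∷ʳ (v ∷ vs) w = refl

  canonical-reverse : (xs : List (Fin q)) → T (canonical xs) → T (not (canonical (reverse xs)))
  canonical-reverse xs c with reverseView xs
  ... | [] = ⊥-elim c
  ... | [] ∶ _ ∶ʳ w = ⊥-elim (<-irrefl refl (<ᵇ⇒< (toℕ w) (toℕ w) c))
  ... | (v ∷ vs) ∶ _ ∶ʳ w
    rewrite canonical-∷-∷ʳ v vs w | reverse-∷-∷ʳ v vs w | canonical-∷-∷ʳ w (reverse vs) v
    = T-not (<⇒≯ (<ᵇ⇒< (toℕ v) (toℕ w) c) ∘ <ᵇ⇒< (toℕ w) (toℕ v))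

module _ {q : ℕ} (G : Graph q) where

  Adjacent : Fin q × Fin q → Set
  Adjacent = T ∘ uncurry (adj G)

  walk⇒steps-adjacent : (xs : List (Fin q)) → T (walkᵇ G xs) → All Adjacent (steps xs)
  walk⇒steps-adjacent []           _ = []
  walk⇒steps-adjacent (u ∷ [])     _ = []
  walk⇒steps-adjacent (u ∷ v ∷ vs) w =
    let (uv , w′) = Equivalence.to T-∧ w in uv ∷ walk⇒steps-adjacent (v ∷ vs) w′

  steps-adjacent⇒walk : (xs : List (Fin q)) → All Adjacent (steps xs) → T (walkᵇ G xs)
  steps-adjacent⇒walk []           _           = _
  steps-adjacent⇒walk (u ∷ [])     _           = _
  steps-adjacent⇒walk (u ∷ v ∷ vs) (uv ∷ adjs) =
    Equivalence.from T-∧ (uv , steps-adjacent⇒walk (v ∷ vs) adjs)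

  walkᵇ-reverse : (xs : List (Fin q)) → T (walkᵇ G xs) → T (walkᵇ G (reverse xs))
  walkᵇ-reverse xs w = steps-adjacent⇒walk (reverse xs) (subst (All Adjacent) (sym (steps-reverse xs))
    (All-resp-↭ (↭-sym (↭-reverse _)) (All.map⁺ (All.map flipped (walk⇒steps-adjacent xs w)))))
    where
    flipped : ∀ {e} → Adjacent e → Adjacent (swap e)
    flipped {u , v} = subst T (adj-sym G u v)

  isPathᵇ⇒walk×canonical : (xs : List (Fin q)) → T (isPathᵇ G xs) → T (walkᵇ G xs) × T (canonical xs)
  isPathᵇ⇒walk×canonical xs path =
    Equivalence.to (T-∧ {walkᵇ G xs}) (proj₂ (Equivalence.to (T-∧ {distinct xs}) path))

  IsOrientation : (Fin q → Fin q → Bool) → Set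
  IsOrientation o = ∀ {u v} → T (adj G u v) → 𝟙 (o u v) + 𝟙 (o v u) ≡ 1

  forward+backward : {o : Fin q → Fin q → Bool} → IsOrientation o →
                     (xs : List (Fin q)) → T (walkᵇ G xs) →
                     forward o xs + forward (flip o) xs ≡ length (steps xs)
  forward+backward orient xs w =
    trans (∑-+ _ _ (steps xs)) (∑-All-≡1 (All.map orient (walk⇒steps-adjacent xs w)))

≤ᵇ-𝟙+ : ∀ t b n → (t ≤ᵇ 𝟙 b + n) ≡ (t ∸ 𝟙 b ≤ᵇ n)
≤ᵇ-𝟙+ t             false n = refl
≤ᵇ-𝟙+ zero          true n = refl
≤ᵇ-𝟙+ (suc zero)    true n = refl
≤ᵇ-𝟙+ (suc (suc t)) true n = refl

pigeonhole : ∀ {d t f b} → t ≤ suc d → f + b ≡ d + t → f < t → t ≤ b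
pigeonhole {d} {t} {f} {b} t≤1+d f+b≡d+t f<t = ≮⇒≥ λ b<t →
  <-irrefl f+b≡d+t (subst (f + b <_) (+-comm t d) (+-mono-<-≤ f<t (s≤s⁻¹ (≤-trans b<t t≤1+d))))

𝟙<ᵇ+𝟙>ᵇ≡1 : ∀ {m n} → m ≢ n → 𝟙 (m <ᵇ n) + 𝟙 (n <ᵇ m) ≡ 1
𝟙<ᵇ+𝟙>ᵇ≡1 {zero}  {zero}  m≢n = ⊥-elim (m≢n refl)
𝟙<ᵇ+𝟙>ᵇ≡1 {zero}  {suc n} _   = refl
𝟙<ᵇ+𝟙>ᵇ≡1 {suc m} {zero}  _   = refl
𝟙<ᵇ+𝟙>ᵇ≡1 {suc m} {suc n} m≢n = 𝟙<ᵇ+𝟙>ᵇ≡1 (m≢n ∘ cong suc)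

module WalkCount {q : ℕ} (G : Graph q) (o : Fin q → Fin q → Bool) where

  walk≥ᵇ : ℕ → List (Fin q) → Bool
  walk≥ᵇ t xs = walkᵇ G xs ∧ (t ≤ᵇ forward o xs)

  #walks≥ : Fin q → ℕ → ℕ → ℕ
  #walks≥ v k t = ∑ (𝟙 ∘ walk≥ᵇ t ∘ (v ∷_)) (allLists q k)

  outDeg : Fin q → ℕ
  outDeg v = ∑ (λ w → 𝟙 (o v w ∧ adj G v w)) (allFin q)

  #walks≥-suc : ∀ v k t →
    #walks≥ v (suc k) t ≡ ∑ (λ w → 𝟙 (adj G v w) * #walks≥ w k (t ∸ 𝟙 (o v w))) (allFin q)
  #walks≥-suc v k t = trans (∑-allLists-∷ (𝟙 ∘ walk≥ᵇ t ∘ (v ∷_)) k) (∑-cong first-step (allFin q))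
    where
    first-step : ∀ w → ∑ (λ ys → 𝟙 (walk≥ᵇ t (v ∷ w ∷ ys))) (allLists q k)
                       ≡ 𝟙 (adj G v w) * #walks≥ w k (t ∸ 𝟙 (o v w))
    first-step w with adj G v w
    ... | false = ∑-zero (allLists q k)
    ... | true  = trans (∑-cong (λ ys → cong (𝟙 ∘ (walkᵇ G (w ∷ ys) ∧_)) (≤ᵇ-𝟙+ t (o v w) _))
                                (allLists q k))
                        (sym (+-identityʳ _))

  #walks≥-vanish : ∀ v k t → k < t → #walks≥ v k t ≡ 0
  #walks≥-vanish v k t k<t = n≤0⇒n≡0 (begin
    #walks≥ v k t
      ≤⟨ ∑-allLists-mono-≤ k (λ ys ∣ys∣≡k → ≤-reflexive (¬T⇒𝟙≡0 (too-few ys ∣ys∣≡k))) ⟩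
    ∑ (λ _ → 0) (allLists q k)
      ≡⟨ ∑-zero (allLists q k) ⟩
    0
      ∎)
    where
    open ≤-Reasoning
    too-few : ∀ ys → length ys ≡ k → ¬ T (walk≥ᵇ t (v ∷ ys))
    too-few ys ∣ys∣≡k w = <⇒≱ k<t (begin
      t                        ≤⟨ ≤ᵇ⇒≤ t _ (proj₂ (Equivalence.to T-∧ w)) ⟩
      forward o (v ∷ ys)       ≤⟨ forward≤length o (v ∷ ys) ⟩
      length (steps (v ∷ ys))  ≡⟨ length-steps v ys ⟩
      length ys                ≡⟨ ∣ys∣≡k ⟩
      k                        ∎)

  module _ {m Δ : ℕ} (outDeg≤ : ∀ v → outDeg v ≤ m) (deg≤ : ∀ v → deg G v ≤ Δ) where

    #neighbours≤ : ∀ v → ∑ (𝟙 ∘ adj G v) (allFin q) ≤ Δ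
    #neighbours≤ v = subst (_≤ Δ) (length-filterᵇ (adj G v) (allFin q)) (deg≤ v)

    #walks≥-suc≤ : ∀ v k t {A B} → (∀ w → #walks≥ w k (t ∸ 1) ≤ A) → (∀ w → #walks≥ w k t ≤ B) →
                   #walks≥ v (suc k) t ≤ m * A + Δ * B
    #walks≥-suc≤ v k t {A} {B} ≤A ≤B = begin
      #walks≥ v (suc k) t
        ≡⟨ #walks≥-suc v k t ⟩
      ∑ (λ w → 𝟙 (adj G v w) * #walks≥ w k (t ∸ 𝟙 (o v w))) (allFin q)
        ≤⟨ ∑-mono-≤ (λ w → split (adj G v w) (o v w) (λ s → #walks≥ w k s) (≤A w) (≤B w)) (allFin q) ⟩
      ∑ (λ w → 𝟙 (o v w ∧ adj G v w) * A + 𝟙 (adj G v w) * B) (allFin q)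
        ≡⟨ ∑-+ (λ w → 𝟙 (o v w ∧ adj G v w) * A) (λ w → 𝟙 (adj G v w) * B) (allFin q) ⟨
      ∑ (λ w → 𝟙 (o v w ∧ adj G v w) * A) (allFin q) + ∑ (λ w → 𝟙 (adj G v w) * B) (allFin q)
        ≡⟨ cong₂ _+_ (∑-*ʳ _ A (allFin q)) (∑-*ʳ _ B (allFin q)) ⟩
      outDeg v * A + ∑ (𝟙 ∘ adj G v) (allFin q) * B
        ≤⟨ +-mono-≤ (*-monoˡ-≤ A (outDeg≤ v)) (*-monoˡ-≤ B (#neighbours≤ v)) ⟩
      m * A + Δ * B
        ∎
      where
      open ≤-Reasoning
      split : ∀ a b (W : ℕ → ℕ) → W (t ∸ 1) ≤ A → W t ≤ B →
              𝟙 a * W (t ∸ 𝟙 b) ≤ 𝟙 (b ∧ a) * A + 𝟙 a * B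
      split false b     W _   _   = z≤n
      split true  true  W W≤A _   = ≤-trans (+-monoˡ-≤ 0 W≤A) (m≤m+n _ _)
      split true  false W _   W≤B = +-monoˡ-≤ 0 W≤B

    #walks≥-suc-zero≤ : ∀ v k {B} → (∀ w → #walks≥ w k 0 ≤ B) → #walks≥ v (suc k) 0 ≤ Δ * B
    #walks≥-suc-zero≤ v k {B} ≤B = begin
      #walks≥ v (suc k) 0
        ≡⟨ #walks≥-suc v k 0 ⟩
      ∑ (λ w → 𝟙 (adj G v w) * #walks≥ w k (0 ∸ 𝟙 (o v w))) (allFin q)
        ≤⟨ ∑-mono-≤ (λ w → *-monoʳ-≤ (𝟙 (adj G v w)) (≤B′ w)) (allFin q) ⟩
      ∑ (λ w → 𝟙 (adj G v w) * B) (allFin q)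
        ≡⟨ ∑-*ʳ (𝟙 ∘ adj G v) B (allFin q) ⟩
      ∑ (𝟙 ∘ adj G v) (allFin q) * B
        ≤⟨ *-monoˡ-≤ B (#neighbours≤ v) ⟩
      Δ * B
        ∎
      where
      open ≤-Reasoning
      ≤B′ : ∀ w → #walks≥ w k (0 ∸ 𝟙 (o v w)) ≤ B
      ≤B′ w = subst (λ s → #walks≥ w k s ≤ B) (sym (0∸n≡0 (𝟙 (o v w)))) (≤B w)

    walkBound : ℕ → ℕ → ℕ
    walkBound d t = 2 ^ (d + t) * m ^ t * Δ ^ d

    Δ*walkBound≤ : ∀ d → Δ * walkBound d 0 ≤ walkBound (suc d) 0
    Δ*walkBound≤ d = ≤-trans (m≤m+n _ _) (≤-reflexive (double Δ (2 ^ (d + 0)) (Δ ^ d)))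
      where
      double : ∀ Δ P D → Δ * (P * 1 * D) + Δ * (P * 1 * D) ≡ 2 * P * 1 * (Δ * D)
      double = solve-∀

    m*walkBound≤ : ∀ t → m * walkBound 0 t ≤ walkBound 0 (suc t)
    m*walkBound≤ t = ≤-trans (m≤m+n _ _) (≤-reflexive (double m (2 ^ t) (m ^ t)))
      where
      double : ∀ m P M → m * (P * M * 1) + m * (P * M * 1) ≡ 2 * P * (m * M) * 1
      double = solve-∀

    walkBound-recurrence : ∀ d t →
      m * walkBound (suc d) t + Δ * walkBound d (suc t) ≡ walkBound (suc d) (suc t)
    walkBound-recurrence d t = begin
      m * walkBound (suc d) t + Δ * (2 ^ (d + suc t) * m ^ suc t * Δ ^ d)
        ≡⟨ cong (λ e → m * walkBound (suc d) t + Δ * (2 ^ e * m ^ suc t * Δ ^ d)) (+-suc d t) ⟩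
      m * (2 * P * m ^ t * (Δ * Δ ^ d)) + Δ * (2 * P * (m * m ^ t) * Δ ^ d)
        ≡⟨ combine m Δ P (m ^ t) (Δ ^ d) ⟩
      2 * (2 * P) * (m * m ^ t) * (Δ * Δ ^ d)
        ≡⟨ cong (λ e → 2 * 2 ^ e * m ^ suc t * Δ ^ suc d) (+-suc d t) ⟨
      walkBound (suc d) (suc t)
        ∎
      where
      open ≡-Reasoning
      P : ℕ
      P = 2 ^ (d + t)
      combine : ∀ m Δ P M D →
                m * (2 * P * M * (Δ * D)) + Δ * (2 * P * (m * M) * D) ≡ 2 * (2 * P) * (m * M) * (Δ * D)
      combine = solve-∀

    #walks≥≤ : ∀ d t v → #walks≥ v (d + t) t ≤ walkBound d t
    #walks≥≤ zero    zero    v = ≤-refl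
    #walks≥≤ (suc d) zero    v =
      ≤-trans (#walks≥-suc-zero≤ v (d + 0) (#walks≥≤ d 0)) (Δ*walkBound≤ d)
    #walks≥≤ zero    (suc t) v = begin
      #walks≥ v (suc t) (suc t)
        ≤⟨ #walks≥-suc≤ v t (suc t) (#walks≥≤ zero t)
                        (λ w → ≤-reflexive (#walks≥-vanish w t (suc t) (n<1+n t))) ⟩
      m * walkBound 0 t + Δ * 0
        ≡⟨ trans (cong (m * walkBound 0 t +_) (*-zeroʳ Δ)) (+-identityʳ _) ⟩
      m * walkBound 0 t
        ≤⟨ m*walkBound≤ t ⟩
      walkBound 0 (suc t)
        ∎
      where open ≤-Reasoning
    #walks≥≤ (suc d) (suc t) v =
      ≤-trans (#walks≥-suc≤ v (d + suc t) (suc t) ih (#walks≥≤ d (suc t)))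
              (≤-reflexive (walkBound-recurrence d t))
      where
      ih : ∀ w → #walks≥ w (d + suc t) t ≤ walkBound (suc d) t
      ih w = subst (λ k → #walks≥ w k t ≤ walkBound (suc d) t) (sym (+-suc d t)) (#walks≥≤ (suc d) t w)

    #walks≥-total≤ : ∀ d t → ∑ (𝟙 ∘ walk≥ᵇ t) (allLists q (suc (d + t))) ≤ q * walkBound d t
    #walks≥-total≤ d t = begin
      ∑ (𝟙 ∘ walk≥ᵇ t) (allLists q (suc (d + t)))
        ≡⟨ ∑-allLists-∷ (𝟙 ∘ walk≥ᵇ t) (d + t) ⟩
      ∑ (λ v → #walks≥ v (d + t) t) (allFin q)
        ≤⟨ ∑-≤-length* (#walks≥≤ d t) (allFin q) ⟩
      length (allFin q) * walkBound d t
        ≡⟨ cong (_* walkBound d t) (length-tabulate {n = q} id) ⟩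
      q * walkBound d t
        ∎
      where open ≤-Reasoning

    module _ (orient : IsOrientation G o) {d t : ℕ} (t≤1+d : t ≤ suc d) where

      path-orientation : ∀ xs → length xs ≡ suc (d + t) → T (isPathᵇ G xs) →
        T (walk≥ᵇ t xs ∧ canonical xs) ⊎ T (walk≥ᵇ t (reverse xs) ∧ not (canonical (reverse xs)))
      path-orientation xs@(x ∷ xs′) ∣xs∣ path = orient-by (t ≤? forward o xs)
        where
        walk : T (walkᵇ G xs)
        walk = proj₁ (isPathᵇ⇒walk×canonical G xs path)
        canon : T (canonical xs)
        canon = proj₂ (isPathᵇ⇒walk×canonical G xs path)
        F+B≡d+t : forward o xs + forward (flip o) xs ≡ d + t
        F+B≡d+t = trans (forward+backward G orient xs walk)
                        (trans (length-steps x xs′) (suc-injective ∣xs∣))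
        orient-by : Dec (t ≤ forward o xs) →
          T (walk≥ᵇ t xs ∧ canonical xs) ⊎ T (walk≥ᵇ t (reverse xs) ∧ not (canonical (reverse xs)))
        orient-by (yes t≤F) =
          inj₁ (Equivalence.from T-∧ (Equivalence.from T-∧ (walk , ≤⇒≤ᵇ t≤F) , canon))
        orient-by (no  t≰F) = inj₂ (Equivalence.from T-∧
          (Equivalence.from T-∧ (walkᵇ-reverse G xs walk , ≤⇒≤ᵇ t≤B) , canonical-reverse xs canon))
          where
          t≤B : t ≤ forward o (reverse xs)
          t≤B = subst (t ≤_) (sym (forward-reverse o xs)) (pigeonhole t≤1+d F+B≡d+t (≰⇒> t≰F))

      numPaths≤ : numPaths G (d + t) ≤ q * 2 ^ (d + t) * m ^ t * Δ ^ d
      numPaths≤ = begin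
        numPaths G (d + t)
          ≡⟨ length-filterᵇ (isPathᵇ G) (allLists q (suc (d + t))) ⟩
        ∑ (𝟙 ∘ isPathᵇ G) (allLists q (suc (d + t)))
          ≤⟨ ∑-allLists-mono-≤ (suc (d + t)) (λ xs ∣xs∣ → 𝟙-≤-+ (path-orientation xs ∣xs∣)) ⟩
        ∑ (λ xs → 𝟙 (walk≥ᵇ t xs ∧ canonical xs)
                  + 𝟙 (walk≥ᵇ t (reverse xs) ∧ not (canonical (reverse xs)))) (allLists q (suc (d + t)))
          ≡⟨ ∑-allLists-reverse-split (walk≥ᵇ t) canonical (suc (d + t)) ⟩
        ∑ (𝟙 ∘ walk≥ᵇ t) (allLists q (suc (d + t)))
          ≤⟨ #walks≥-total≤ d t ⟩
        q * walkBound d t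
          ≡⟨ reassociate q (2 ^ (d + t)) (m ^ t) (Δ ^ d) ⟩
        q * 2 ^ (d + t) * m ^ t * Δ ^ d
          ∎
        where
        open ≤-Reasoning
        reassociate : ∀ q a b c → q * (a * b * c) ≡ q * a * b * c
        reassociate = solve-∀

module Degeneracy {q : ℕ} (G : Graph q) (z : ℕ) where

  ∣_∣ : (Fin q → Bool) → ℕ
  ∣ S ∣ = ∑ (𝟙 ∘ S) (allFin q)

  _∖_ : (Fin q → Bool) → Fin q → Fin q → Bool
  (S ∖ p) w = not ⌊ w ≟ p ⌋ ∧ S w

  ∈-∖ : ∀ S {p w} → w ≢ p → T (S w) → T ((S ∖ p) w)
  ∈-∖ S {p} {w} w≢p Sw with w ≟ p
  ... | yes w≡p = w≢p w≡p
  ... | no  _   = Sw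

  ∣∖∣< : ∀ S {p} → T (S p) → ∣ S ∖ p ∣ < ∣ S ∣
  ∣∖∣< S {p} Sp = ∑-mono-< (λ w → 𝟙-∧-≤ʳ (not ⌊ w ≟ p ⌋) (S w)) (∈-allFin p) removed
    where
    removed : 𝟙 ((S ∖ p) p) < 𝟙 (S p)
    removed with p ≟ p
    ... | yes _   = subst (0 <_) (sym (T⇒𝟙≡1 Sp)) z<s
    ... | no  p≢p = ⊥-elim (p≢p refl)

  induced : (Fin q → Bool) → Subgraph G
  induced S = record
    { vert     = S
    ; edge     = λ u v → S u ∧ S v ∧ adj G u v
    ; edge-sym = sym-edge
    ; edge⊆G   = λ u v → proj₂ ∘ Equivalence.to (T-∧ {S v}) ∘ proj₂ ∘ Equivalence.to (T-∧ {S u})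
    ; edge-in  = λ u v → proj₁ ∘ Equivalence.to (T-∧ {S u})
    }
    where
    sym-edge : ∀ u v → (S u ∧ S v ∧ adj G u v) ≡ (S v ∧ S u ∧ adj G v u)
    sym-edge u v rewrite adj-sym G u v with S u | S v
    ... | true  | true  = refl
    ... | true  | false = refl
    ... | false | true  = refl
    ... | false | false = refl

  subDeg-induced : ∀ S {v} → T (S v) → subDeg (induced S) v ≡ ∑ (λ w → 𝟙 (S w ∧ adj G v w)) (allFin q)
  subDeg-induced S {v} Sv with S v
  ... | true = length-filterᵇ (λ w → S w ∧ adj G v w) (allFin q)

  record DegeneracyOrdering (S : Fin q → Bool) : Set where
    field
      rank           : Fin q → ℕ
      rank-injective : ∀ {u v} → T (S u) → T (S v) → rank u ≡ rank v → u ≡ v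
      #later≤        : ∀ {v} → T (S v) → ∑ (λ w → 𝟙 ((rank v <ᵇ rank w) ∧ S w ∧ adj G v w)) (allFin q) ≤ z

  ordering-∅ : ∀ {S} → (∀ v → ¬ T (S v)) → DegeneracyOrdering S
  ordering-∅ S-empty = record
    { rank           = λ _ → 0
    ; rank-injective = λ {u} Su _ _ → ⊥-elim (S-empty u Su)
    ; #later≤        = λ {v} Sv → ⊥-elim (S-empty v Sv)
    }

  ordering-extend : ∀ {S p} → T (S p) → ∑ (λ w → 𝟙 (S w ∧ adj G p w)) (allFin q) ≤ z →
                    DegeneracyOrdering (S ∖ p) → DegeneracyOrdering S
  ordering-extend {S} {p} Sp #nbrs≤z order = record
    { rank           = rank
    ; rank-injective = injective
    ; #later≤        = later≤
    }
    where
    open DegeneracyOrdering order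
      renaming (rank to rank′; rank-injective to injective′; #later≤ to later≤′)

    rank : Fin q → ℕ
    rank w with w ≟ p
    ... | yes _ = 0
    ... | no  _ = suc (rank′ w)

    injective : ∀ {u v} → T (S u) → T (S v) → rank u ≡ rank v → u ≡ v
    injective {u} {v} Su Sv eq with u ≟ p | v ≟ p
    ... | yes u≡p | yes v≡p = trans u≡p (sym v≡p)
    ... | no  u≢p | no  v≢p = injective′ (∈-∖ S u≢p Su) (∈-∖ S v≢p Sv) (suc-injective eq)

    later-term≤ : ∀ v w →
      𝟙 ((suc (rank′ v) <ᵇ rank w) ∧ S w ∧ adj G v w)
        ≤ 𝟙 ((rank′ v <ᵇ rank′ w) ∧ (S ∖ p) w ∧ adj G v w)
    later-term≤ v w with w ≟ p
    ... | yes _ = z≤n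
    ... | no  _ = ≤-refl

    later≤ : ∀ {v} → T (S v) → ∑ (λ w → 𝟙 ((rank v <ᵇ rank w) ∧ S w ∧ adj G v w)) (allFin q) ≤ z
    later≤ {v} Sv with v ≟ p
    ... | yes refl = ≤-trans (∑-mono-≤ (λ w → 𝟙-∧-≤ʳ (0 <ᵇ rank w) _) (allFin q)) #nbrs≤z
    ... | no  v≢p  = ≤-trans (∑-mono-≤ (later-term≤ v) (allFin q)) (later≤′ (∈-∖ S v≢p Sv))

  ordering : Degenerate z G → ∀ n S → ∣ S ∣ ≤ n → DegeneracyOrdering S
  ordering D zero S ∣S∣≤0 = ordering-∅ λ v Sv →
    <-irrefl refl (≤-trans (≤-reflexive (sym (T⇒𝟙≡1 Sv)))
                           (≤-trans (∈⇒≤∑ (𝟙 ∘ S) (∈-allFin v)) ∣S∣≤0))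
  ordering D (suc n) S ∣S∣≤1+n with any? (λ v → T? (S v))
  ... | no  S-empty    = ordering-∅ λ v Sv → S-empty (v , Sv)
  ... | yes S-nonempty with D (induced S) S-nonempty
  ...   | p , Sp , deg≤z = ordering-extend Sp (subst (_≤ z) (subDeg-induced S Sp) deg≤z)
                             (ordering D n (S ∖ p) (s≤s⁻¹ (≤-trans (∣∖∣< S Sp) ∣S∣≤1+n)))

  module _ (order : DegeneracyOrdering (λ _ → true)) where
    open DegeneracyOrdering order

    ordering-isOrientation : IsOrientation G (λ u v → rank u <ᵇ rank v)
    ordering-isOrientation {u} {v} uv =
      𝟙<ᵇ+𝟙>ᵇ≡1 (λ ranks≡ → irreflexive (rank-injective _ _ ranks≡))
      where
      irreflexive : u ≢ v
      irreflexive refl = subst T (irrefl G u) uv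

    ordering-outDeg≤ : ∀ v → ∑ (λ w → 𝟙 ((rank v <ᵇ rank w) ∧ adj G v w)) (allFin q) ≤ z
    ordering-outDeg≤ v = #later≤ _

  degeneracyOrdering : Degenerate z G → DegeneracyOrdering (λ _ → true)
  degeneracyOrdering D = ordering D _ (λ _ → true) ≤-refl

∈⇒≤foldr-⊔ : {A : Set} (f : A → ℕ) {x : A} {xs : List A} →
             x ∈ xs → f x ≤ foldr (λ y n → f y ⊔ n) 0 xs
∈⇒≤foldr-⊔ f {xs = y ∷ xs} (here refl)  = m≤m⊔n (f y) _
∈⇒≤foldr-⊔ f {xs = y ∷ xs} (there x∈xs) = ≤-trans (∈⇒≤foldr-⊔ f x∈xs) (m≤n⊔m (f y) _)

deg≤maxDeg : ∀ {q} (G : Graph q) v → deg G v ≤ maxDeg G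
deg≤maxDeg G v = ∈⇒≤foldr-⊔ (deg G) (∈-allFin v)

lemma4p5 : (ℓ z q : ℕ) → 1 ≤ ℓ → 1 ≤ z → (G₀ : Graph q) → Degenerate z G₀ →
    numPaths G₀ ℓ ≤ q * 2 ^ ℓ * z ^ ⌈ ℓ /2⌉ * maxDeg G₀ ^ ⌊ ℓ /2⌋
lemma4p5 ℓ z q _ _ G₀ D =
  subst (λ k → numPaths G₀ k ≤ q * 2 ^ k * z ^ ⌈ ℓ /2⌉ * maxDeg G₀ ^ ⌊ ℓ /2⌋) (⌊n/2⌋+⌈n/2⌉≡n ℓ)
    (numPaths≤ G₀ (λ u v → rank u <ᵇ rank v) (ordering-outDeg≤ order) (deg≤maxDeg G₀)
               (ordering-isOrientation order) ⌈ℓ/2⌉≤1+⌊ℓ/2⌋)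
  where
  open WalkCount using (numPaths≤)
  open Degeneracy G₀ z
  order : DegeneracyOrdering (λ _ → true)
  order = degeneracyOrdering D
  open DegeneracyOrdering order using (rank)
  -- ⌈ ℓ /2⌉ is ⌊ 1 + ℓ /2⌋ and ⌈ 1 + ℓ /2⌉ is 1 + ⌊ ℓ /2⌋.
  ⌈ℓ/2⌉≤1+⌊ℓ/2⌋ : ⌈ ℓ /2⌉ ≤ suc ⌊ ℓ /2⌋
  ⌈ℓ/2⌉≤1+⌊ℓ/2⌋ = ⌊n/2⌋≤⌈n/2⌉ (suc ℓ)
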